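{- Let $S$ be a (possibly infinite) binary string with $VCdim(S)=d+1$ for some $d\in\mathbb{N}$. Then $S$ contains a $d$-prime substring. In particular, every $(d+1)$-prime string contains a $d$-prime string as a substring.
   Context: For a finite binary string $s$ (indexed from $0$), $n(s)=\{i: s_i=1\}$; for a (finite or right-infinite) binary string $S$, $\mathfrak{S}=\{n(s): s \text{ a finite contiguous substring of } S\}$; a set $B\subseteq\mathbb{N}$ is shattered if $\{c\cap B: c\in\mathfrak{S}\}$ is the power set of $B$; $VCdim(S)$ is the largest size of a shattered set. A binary string $S$ is $d$-prime if $VCdim(S)=d$ and every proper contiguous substring $S'$ of $S$ has $VCdim(S')<d$. -}

module Defs where

open import Data.Bool using (Bool; true; false)
open import Data.Nat using (ℕ; zero; suc; _+_; _≤_; _<_)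
open import Data.List using (List; []; _∷_; length; map; upTo)
open import Data.List.Membership.Propositional using (_∈_)
open import Data.List.Relation.Unary.Unique.Propositional using (Unique)
open import Data.Product using (Σ; ∃; _×_)
open import Data.Empty using (⊥)
open import Data.Unit using (⊤)
open import Relation.Nullary using (¬_)
open import Relation.Binary.PropositionalEquality using (_≡_)
open import Function.Bundles using (_⇔_)

data BStr : Set where
  fin : List Bool → BStr
  inf : (ℕ → Bool) → BStr

-- character at a position of a list (false out of range; only used in range)
lookupB : List Bool → ℕ → Bool
lookupB []      _       = false
lookupB (b ∷ s) zero    = b
lookupB (b ∷ s) (suc i) = lookupB s i

at : BStr → ℕ → Bool
at (fin s) i = lookupB s i
at (inf f) i = f i

InRange : BStr → ℕ → ℕ → Set
InRange (fin s) i k = i + k ≤ length s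
InRange (inf f) i k = ⊤

slice : BStr → ℕ → ℕ → List Bool
slice S i k = map (λ j → at S (i + j)) (upTo k)

FinSub : List Bool → BStr → Set
FinSub s S = Σ ℕ λ i → Σ ℕ λ k → InRange S i k × (s ≡ slice S i k)

_∈n_ : ℕ → List Bool → Set
x     ∈n []      = ⊥
zero  ∈n (b ∷ s) = b ≡ true
suc x ∈n (b ∷ s) = x ∈n s

-- a finite set B ⊆ ℕ (a duplicate-free list) is shattered by S: every subset
-- of B (given by a predicate P restricted to B) is c ∩ B for some c ∈ 𝔖(S)
Shattered : BStr → List ℕ → Set
Shattered S B = (P : ℕ → Bool) →
  ∃ λ s → FinSub s S × (∀ x → x ∈ B → (x ∈n s ⇔ P x ≡ true))

HasVCdim : BStr → ℕ → Set
HasVCdim S d =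
  (∃ λ B → Unique B × length B ≡ d × Shattered S B) ×
  (∀ B → Unique B → Shattered S B → length B ≤ d)

_⊑_ : BStr → BStr → Set
fin s ⊑ S     = FinSub s S
inf T ⊑ fin _ = ⊥
inf T ⊑ inf U = ∃ λ i → ∀ j → T j ≡ U (i + j)

_≈S_ : BStr → BStr → Set
fin s ≈S fin t = s ≡ t
fin _ ≈S inf _ = ⊥
inf _ ≈S fin _ = ⊥
inf T ≈S inf U = ∀ j → T j ≡ U j

Prime : ℕ → BStr → Set
Prime d S = HasVCdim S d ×
  (∀ S' → S' ⊑ S → ¬ (S' ≈S S) → ∀ d' → HasVCdim S' d' → d' < d)

-- A string shatters a finite set iff some finite prefix does, since finitely many
-- witnesses suffice. Starting from a finite T with VCdim(T) ≥ d, drop the first or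
-- the last letter as long as some d-set stays shattered. The resulting string v is
-- d-prime: every proper substring lies in v minus one of its ends, and if v shattered
-- a (d+1)-set B, cutting each witness just before the largest element b of B would
-- let v minus its last letter shatter B ∖ {b}. So VCdim(S) ≥ d already suffices.
module Submission where

open import Defs
open import Data.Bool using (Bool; true; false)
open import Data.Bool.Properties using () renaming (_≟_ to _≟ᵇ_)
open import Data.Nat using (ℕ; zero; suc; _+_; _≤_; _<_; _⊔_; pred; z≤n; s≤s; s≤s⁻¹; z<s; s<s; _≤?_; _<?_; _≟_)
open import Data.Nat.Properties
open import Data.List using (List; []; _∷_; [_]; length; map; upTo; applyUpTo; filter; take; _++_; cartesianProduct; cartesianProductWith)
open import Data.List.Properties using (map-applyUpTo; map-cong-local; length-map; length-upTo; length-take; filter-all; filter-accept; filter-reject)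
open import Data.List.Membership.Propositional using (_∈_; lose)
open import Data.List.Membership.Propositional.Properties
  using (∈-++⁺ˡ; ∈-++⁺ʳ; ∈-filter⁺; ∈-filter⁻; ∈-map⁺; ∈-map⁻; ∈-upTo⁺; ∈-upTo⁻; ∈-cartesianProduct⁺; ∈-cartesianProductWith⁺)
open import Data.List.Relation.Binary.Subset.Propositional using (_⊆_)
open import Data.List.Relation.Binary.Sublist.Propositional.Properties using (Any-resp-⊆; take-⊆)
open import Data.List.Relation.Unary.Any as Any using (Any; here; there; satisfied)
open import Data.List.Relation.Unary.All as All using (All; []; _∷_)
open import Data.List.Relation.Unary.All.Properties using (all-filter) renaming (++⁺ to All-++⁺)
open import Data.List.Relation.Unary.AllPairs using (_∷_)
open import Data.List.Relation.Unary.Unique.Propositional using (Unique)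
import Data.List.Relation.Unary.Unique.Propositional.Properties as Unique
open import Data.List.Relation.Unary.Unique.DecPropositional _≟_ using (unique?)
open import Data.List.Extrema.Nat using (max; ⊥≤max; xs≤max; argmax-sel)
open import Data.Product using (∃; _×_; _,_; proj₁; proj₂; uncurry)
open import Data.Sum using (_⊎_; inj₁; inj₂)
import Data.Sum as Sum
open import Data.Empty using (⊥-elim)
open import Data.Unit using (tt)
open import Function using (_∘_; id; case_of_)
open import Function.Bundles using (_⇔_; mk⇔; Equivalence)
import Function.Properties.Equivalence as ⇔
open import Relation.Nullary using (¬_; Dec; yes; no)
open import Relation.Nullary.Decidable using (map′; ¬?; _×-dec_)
open import Relation.Unary using (Decidable)
open import Relation.Binary.PropositionalEquality using (_≡_; _≢_; refl; sym; trans; cong; subst)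

lookupB-applyUpTo : ∀ (f : ℕ → Bool) {k j} → j < k → lookupB (applyUpTo f k) j ≡ f j
lookupB-applyUpTo f {suc k} {zero}  _         = refl
lookupB-applyUpTo f {suc k} {suc j} (s≤s j<k) = lookupB-applyUpTo (f ∘ suc) j<k

applyUpTo-lookupB : ∀ u → applyUpTo (lookupB u) (length u) ≡ u
applyUpTo-lookupB []      = refl
applyUpTo-lookupB (b ∷ u) = cong (b ∷_) (applyUpTo-lookupB u)

slice≡applyUpTo : ∀ S i k → slice S i k ≡ applyUpTo (λ j → at S (i + j)) k
slice≡applyUpTo S i k = map-applyUpTo id (λ j → at S (i + j)) k

length-slice : ∀ S i k → length (slice S i k) ≡ k
length-slice S i k = trans (length-map _ (upTo k)) (length-upTo k)

lookupB-slice : ∀ S {i k j} → j < k → lookupB (slice S i k) j ≡ at S (i + j)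
lookupB-slice S {i} {k} {j} j<k =
  trans (cong (λ t → lookupB t j) (slice≡applyUpTo S i k)) (lookupB-applyUpTo _ j<k)

slice-full : ∀ u → slice (fin u) 0 (length u) ≡ u
slice-full u = trans (slice≡applyUpTo (fin u) 0 (length u)) (applyUpTo-lookupB u)

slice-slice : ∀ S {a m i k} → i + k ≤ m → slice (fin (slice S a m)) i k ≡ slice S (a + i) k
slice-slice S {a} {m} {i} {k} i+k≤m = map-cong-local (All.tabulate lookup-shift)
  where
  lookup-shift : ∀ {j} → j ∈ upTo k → lookupB (slice S a m) (i + j) ≡ at S (a + i + j)
  lookup-shift {j} j∈ = trans (lookupB-slice S (≤-trans (+-monoʳ-< i (∈-upTo⁻ j∈)) i+k≤m))
                              (cong (at S) (sym (+-assoc a i j)))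

∈n⁻ : ∀ {x} s → x ∈n s → x < length s × lookupB s x ≡ true
∈n⁻ {zero}  (b ∷ s) x∈ = z<s , x∈
∈n⁻ {suc x} (b ∷ s) x∈ with ∈n⁻ s x∈
... | x<|s| , sₓ = s<s x<|s| , sₓ

∈n⁺ : ∀ {x} s → x < length s → lookupB s x ≡ true → x ∈n s
∈n⁺ {zero}  (b ∷ s) _            sₓ = sₓ
∈n⁺ {suc x} (b ∷ s) (s≤s x<|s|) sₓ = ∈n⁺ s x<|s| sₓ

_∈n?_ : ∀ x s → Dec (x ∈n s)
x     ∈n? []      = no λ ()
zero  ∈n? (b ∷ s) = b ≟ᵇ true
suc x ∈n? (b ∷ s) = x ∈n? s

∈n-slice⁻ : ∀ S {i k y} → y ∈n slice S i k → y < k × at S (i + y) ≡ true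
∈n-slice⁻ S {i} {k} y∈ with ∈n⁻ (slice S i k) y∈
... | y<|s| , sᵧ = y<k , trans (sym (lookupB-slice S y<k)) sᵧ
  where y<k = subst (_ <_) (length-slice S i k) y<|s|

∈n-slice⁺ : ∀ S {i k y} → y < k → at S (i + y) ≡ true → y ∈n slice S i k
∈n-slice⁺ S {i} {k} y<k Sᵢ₊ᵧ =
  ∈n⁺ (slice S i k) (subst (_ <_) (sym (length-slice S i k)) y<k) (trans (lookupB-slice S y<k) Sᵢ₊ᵧ)

∈n-slice-shorten : ∀ S {i j k y} → y < j → j ≤ k → y ∈n slice S i j ⇔ y ∈n slice S i k
∈n-slice-shorten S {i} {j} {k} y<j j≤k = mk⇔
  (λ y∈ → ∈n-slice⁺ S (<-≤-trans y<j j≤k) (proj₂ (∈n-slice⁻ S {i} {j} y∈)))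
  (λ y∈ → ∈n-slice⁺ S y<j (proj₂ (∈n-slice⁻ S {i} {k} y∈)))

InRange-shift : ∀ S {a m i k} → InRange S a m → i + k ≤ m → InRange S (a + i) k
InRange-shift (fin s) {a} {m} {i} {k} a+m≤|s| i+k≤m =
  ≤-trans (≤-reflexive (+-assoc a i k)) (≤-trans (+-monoʳ-≤ a i+k≤m) a+m≤|s|)
InRange-shift (inf f) _ _ = tt

InRange-0 : ∀ S → InRange S 0 0
InRange-0 (fin s) = z≤n
InRange-0 (inf f) = tt

InRange-⊔ : ∀ S {a i k} → InRange S 0 a → InRange S i k → InRange S 0 (a ⊔ (i + k))
InRange-⊔ (fin s) = ⊔-lub
InRange-⊔ (inf f) _ _ = tt

FinSub-refl : ∀ u → FinSub u (fin u)
FinSub-refl u = 0 , length u , ≤-refl , sym (slice-full u)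

FinSub-slice : ∀ S {a m i k} → i + k ≤ m → FinSub (slice S (a + i) k) (fin (slice S a m))
FinSub-slice S {a} {m} {i} {k} i+k≤m =
  i , k , subst (i + k ≤_) (sym (length-slice S a m)) i+k≤m , sym (slice-slice S i+k≤m)

FinSub-trans : ∀ {s t} S → FinSub s (fin t) → FinSub t S → FinSub s S
FinSub-trans S (i , k , i+k≤|t| , refl) (a , m , a+m∈S , refl) =
  a + i , k , InRange-shift S a+m∈S i+k≤m , slice-slice S i+k≤m
  where i+k≤m = subst (i + k ≤_) (length-slice S a m) i+k≤|t|

Realises : List Bool → (ℕ → Bool) → List ℕ → Set
Realises s P B = ∀ x → x ∈ B → (x ∈n s ⇔ P x ≡ true)

ShatteredBy : (List Bool → Set) → List ℕ → Set
ShatteredBy C B = (P : ℕ → Bool) → ∃ λ s → C s × Realises s P B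

ShatteredBy-mono : ∀ {C D : List Bool → Set} {B} → (∀ {s} → C s → D s) → ShatteredBy C B → ShatteredBy D B
ShatteredBy-mono C⇒D sh P with sh P
... | s , c , r = s , C⇒D c , r

ShatteredBy-⊆ : ∀ {C B B′} → B′ ⊆ B → ShatteredBy C B → ShatteredBy C B′
ShatteredBy-⊆ B′⊆B sh P with sh P
... | s , c , r = s , c , λ x x∈ → r x (B′⊆B x∈)

update : (ℕ → Bool) → ℕ → Bool → ℕ → Bool
update P x b y with y ≟ x
... | yes _ = b
... | no  _ = P y

update-≡ : ∀ P x b → update P x b x ≡ b
update-≡ P x b with x ≟ x
... | yes _   = refl
... | no  x≢x = ⊥-elim (x≢x refl)

update-≢ : ∀ P {x} b {y} → x ≢ y → update P x b y ≡ P y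
update-≢ P {x} b {y} x≢y with y ≟ x
... | yes y≡x = ⊥-elim (x≢y (sym y≡x))
... | no  _   = refl

Realises-∷ : ∀ {s P x B} → (x ∈n s ⇔ P x ≡ true) → Realises s P B → Realises s P (x ∷ B)
Realises-∷ hd tl _ (here refl) = hd
Realises-∷ hd tl y (there y∈)  = tl y y∈

ShatteredBy-∷⁻ : ∀ {C x B} → All (x ≢_) B → ShatteredBy C (x ∷ B) →
  ShatteredBy (λ s → C s × x ∈n s) B × ShatteredBy (λ s → C s × ¬ x ∈n s) B
ShatteredBy-∷⁻ {C} {x} {B} x∉B sh =
  (λ P → realise P true (λ x∈s⇔ → Equivalence.from x∈s⇔ refl)) ,
  (λ P → realise P false (λ x∈s⇔ x∈s → case Equivalence.to x∈s⇔ x∈s of λ ()))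
  where
  realise : ∀ P b {Q : List Bool → Set} → (∀ {s} → (x ∈n s ⇔ b ≡ true) → Q s) →
            ∃ λ s → (C s × Q s) × Realises s P B
  realise P b q with sh (update P x b)
  ... | s , c , r = s , (c , q (subst (λ t → x ∈n s ⇔ t ≡ true) (update-≡ P x b) (r x (here refl)))) ,
    λ y y∈ → subst (λ t → y ∈n s ⇔ t ≡ true) (update-≢ P b (All.lookup x∉B y∈)) (r y (there y∈))

ShatteredBy-∷⁺ : ∀ {C x B} → ShatteredBy (λ s → C s × x ∈n s) B → ShatteredBy (λ s → C s × ¬ x ∈n s) B →
  ShatteredBy C (x ∷ B)
ShatteredBy-∷⁺ {x = x} sh₁ sh₀ P with P x in Pₓ
... | true  with sh₁ P
...   | s , (c , x∈s) , r = s , c , Realises-∷ {s} (mk⇔ (λ _ → Pₓ) (λ _ → x∈s)) r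
ShatteredBy-∷⁺ {x = x} sh₁ sh₀ P | false with sh₀ P
...   | s , (c , x∉s) , r = s , c , Realises-∷ {s} (mk⇔ (⊥-elim ∘ x∉s) (λ Pₓ≡true → case trans (sym Pₓ) Pₓ≡true of λ ())) r

ShatteredBy-finite : ∀ {C B} → Unique B → ShatteredBy C B → ∃ λ L → All C L × ShatteredBy (_∈ L) B
ShatteredBy-finite {B = []} _ sh with sh (λ _ → true)
... | s , c , _ = [ s ] , c ∷ [] , λ P → s , here refl , λ _ ()
ShatteredBy-finite {B = x ∷ B} (x∉B ∷ uB) sh with ShatteredBy-∷⁻ x∉B sh
... | sh₁ , sh₀ with ShatteredBy-finite uB sh₁ | ShatteredBy-finite uB sh₀
...   | L₁ , A₁ , w₁ | L₀ , A₀ , w₀ =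
  L₁ ++ L₀ ,
  All-++⁺ (All.map proj₁ A₁) (All.map proj₁ A₀) ,
  ShatteredBy-∷⁺ (ShatteredBy-mono (λ s∈ → ∈-++⁺ˡ s∈ , proj₂ (All.lookup A₁ s∈)) w₁)
                 (ShatteredBy-mono (λ s∈ → ∈-++⁺ʳ L₁ s∈ , proj₂ (All.lookup A₀ s∈)) w₀)

ShatteredBy? : ∀ L B → Unique B → Dec (ShatteredBy (_∈ L) B)
ShatteredBy? []      [] _ = no λ sh → case sh (λ _ → true) of λ { (_ , () , _) }
ShatteredBy? (s ∷ L) [] _ = yes λ P → s , here refl , λ _ ()
ShatteredBy? L (x ∷ B) (x∉B ∷ uB)
  with ShatteredBy? (filter (x ∈n?_) L) B uB | ShatteredBy? (filter (¬? ∘ (x ∈n?_)) L) B uB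
... | yes sh₁ | yes sh₀ = yes (ShatteredBy-∷⁺ (ShatteredBy-mono (∈-filter⁻ _) sh₁) (ShatteredBy-mono (∈-filter⁻ _) sh₀))
... | no ¬sh₁ | _       = no (¬sh₁ ∘ ShatteredBy-mono (uncurry (∈-filter⁺ _)) ∘ proj₁ ∘ ShatteredBy-∷⁻ x∉B)
... | yes _   | no ¬sh₀ = no (¬sh₀ ∘ ShatteredBy-mono (uncurry (∈-filter⁺ _)) ∘ proj₂ ∘ ShatteredBy-∷⁻ x∉B)

windowFits? : ∀ n → Decidable (λ ((i , k) : ℕ × ℕ) → i + k ≤ n)
windowFits? n (i , k) = i + k ≤? n

windows : ℕ → List (ℕ × ℕ)
windows n = filter (windowFits? n) (cartesianProduct (upTo (suc n)) (upTo (suc n)))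

substrings : List Bool → List (List Bool)
substrings w = map (uncurry (slice (fin w))) (windows (length w))

∈-windows⁺ : ∀ {n i k} → i + k ≤ n → (i , k) ∈ windows n
∈-windows⁺ {n} {i} {k} i+k≤n = ∈-filter⁺ (windowFits? n) {x = i , k}
  (∈-cartesianProduct⁺ (∈-upTo⁺ (s≤s (m+n≤o⇒m≤o i i+k≤n))) (∈-upTo⁺ (s≤s (m+n≤o⇒n≤o i i+k≤n)))) i+k≤n

∈-windows⁻ : ∀ {n i k} → (i , k) ∈ windows n → i + k ≤ n
∈-windows⁻ {n} ik∈ = proj₂ (∈-filter⁻ (windowFits? n) {xs = pairs} ik∈)
  where pairs = cartesianProduct (upTo (suc n)) (upTo (suc n))

∈-substrings⁺ : ∀ {s} w → FinSub s (fin w) → s ∈ substrings w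
∈-substrings⁺ w (i , k , i+k≤n , refl) = ∈-map⁺ (uncurry (slice (fin w))) (∈-windows⁺ i+k≤n)

∈-substrings⁻ : ∀ {s} w → s ∈ substrings w → FinSub s (fin w)
∈-substrings⁻ w s∈ with ∈-map⁻ (uncurry (slice (fin w))) s∈
... | (i , k) , ik∈ , refl = i , k , ∈-windows⁻ {length w} ik∈ , refl

Shattered? : ∀ w B → Unique B → Dec (Shattered (fin w) B)
Shattered? w B uB =
  map′ (ShatteredBy-mono (∈-substrings⁻ w)) (ShatteredBy-mono (∈-substrings⁺ w)) (ShatteredBy? (substrings w) B uB)

Shattered-<length : ∀ {w B x} → Shattered (fin w) B → x ∈ B → x < length w
Shattered-<length {w} {x = x} sh x∈ with sh (λ _ → true)
... | _ , (i , k , i+k≤n , refl) , r =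
  <-≤-trans (proj₁ (∈n-slice⁻ (fin w) {i} {k} (Equivalence.from (r x x∈) refl))) (m+n≤o⇒n≤o i i+k≤n)

VCdim≥ : BStr → ℕ → Set
VCdim≥ S d = ∃ λ B → Unique B × length B ≡ d × Shattered S B

VCdim≥-antitone : ∀ {S d e} → d ≤ e → VCdim≥ S e → VCdim≥ S d
VCdim≥-antitone {d = d} d≤e (B , uB , refl , sh) =
  take d B , Unique.take⁺ d uB , trans (length-take d B) (m≤n⇒m⊓n≡m d≤e) , ShatteredBy-⊆ (Any-resp-⊆ (take-⊆ d B)) sh

VCdim≥-FinSub : ∀ {v} S {d} → FinSub v S → VCdim≥ (fin v) d → VCdim≥ S d
VCdim≥-FinSub S v⊑S (B , uB , lB , sh) = B , uB , lB , ShatteredBy-mono (λ s⊑v → FinSub-trans S s⊑v v⊑S) sh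

tuples : ∀ {A : Set} → ℕ → List A → List (List A)
tuples zero    xs = [ [] ]
tuples (suc d) xs = cartesianProductWith _∷_ xs (tuples d xs)

∈-tuples⁺ : ∀ {A : Set} {xs ys : List A} → All (_∈ xs) ys → ys ∈ tuples (length ys) xs
∈-tuples⁺ []           = here refl
∈-tuples⁺ (y∈ ∷ ys∈xs) = ∈-cartesianProductWith⁺ _∷_ y∈ (∈-tuples⁺ ys∈xs)

-- A shattered set lies inside [0, length w), so only finitely many candidates need checking.
VCdim≥? : ∀ w d → Dec (VCdim≥ (fin w) d)
VCdim≥? w d = map′ satisfied complete (Any.any? candidate? (tuples d (upTo (length w))))
  where
  Candidate : List ℕ → Set
  Candidate B = Unique B × length B ≡ d × Shattered (fin w) B
  candidate? : Decidable Candidate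
  candidate? B with unique? B
  ... | no ¬uB = no (¬uB ∘ proj₁)
  ... | yes uB = map′ (uB ,_) proj₂ ((length B ≟ d) ×-dec Shattered? w B uB)
  complete : VCdim≥ (fin w) d → Any Candidate (tuples d (upTo (length w)))
  complete (B , uB , refl , sh) =
    lose (∈-tuples⁺ (All.tabulate (∈-upTo⁺ ∘ Shattered-<length {w} sh))) (uB , refl , sh)

prefix-covers : ∀ S {L} → All (λ s → FinSub s S) L →
  ∃ λ N → InRange S 0 N × All (λ s → FinSub s (fin (slice S 0 N))) L
prefix-covers S [] = 0 , InRange-0 S , []
prefix-covers S ((i , k , i+k∈S , refl) ∷ L⊑S) with prefix-covers S L⊑S
... | N , N∈S , L⊑pre =
  M , InRange-⊔ S N∈S i+k∈S , FinSub-slice S {0} (m≤n⊔m N (i + k)) ∷ All.map extend L⊑pre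
  where
  M = N ⊔ (i + k)
  extend : ∀ {s} → FinSub s (fin (slice S 0 N)) → FinSub s (fin (slice S 0 M))
  extend {s} s⊑pre = FinSub-trans {s} (fin (slice S 0 M)) s⊑pre (FinSub-slice S {0} {i = 0} (m≤m⊔n N (i + k)))

VCdim≥-prefix : ∀ {S d} → VCdim≥ S d → ∃ λ T → FinSub T S × VCdim≥ (fin T) d
VCdim≥-prefix {S} (B , uB , lB , sh) with ShatteredBy-finite uB sh
... | L , L⊑S , shL with prefix-covers S L⊑S
...   | N , N∈S , L⊑pre =
  slice S 0 N , (0 , N , N∈S , refl) , B , uB , lB , ShatteredBy-mono (All.lookup L⊑pre) shL

dropLast dropHead : List Bool → List Bool
dropLast u = slice (fin u) 0 (pred (length u))
dropHead u = slice (fin u) 1 (pred (length u))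

dropLast-FinSub : ∀ u → FinSub (dropLast u) (fin u)
dropLast-FinSub u = 0 , pred (length u) , pred[n]≤n , refl

dropHead-FinSub : ∀ b u → FinSub (dropHead (b ∷ u)) (fin (b ∷ u))
dropHead-FinSub b u = 1 , length u , ≤-refl , refl

dropLast-≢ : ∀ {u} → 0 < length u → dropLast u ≢ u
dropLast-≢ {b ∷ u} _ eq = 1+n≢n (sym (trans (sym (length-slice (fin (b ∷ u)) 0 (length u))) (cong length eq)))

length-dropLast≤ : ∀ {u n} → length u ≤ suc n → length (dropLast u) ≤ n
length-dropLast≤ {u} |u|≤1+n = subst (_≤ _) (sym (length-slice (fin u) 0 (pred (length u)))) (∸-monoˡ-≤ 1 |u|≤1+n)

length-dropHead≤ : ∀ {u n} → length u ≤ suc n → length (dropHead u) ≤ n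
length-dropHead≤ {u} |u|≤1+n = subst (_≤ _) (sym (length-slice (fin u) 1 (pred (length u)))) (∸-monoˡ-≤ 1 |u|≤1+n)

FinSub-[] : ∀ {v} → FinSub v (fin []) → v ≡ []
FinSub-[] (i , zero  , _         , refl) = refl
FinSub-[] (i , suc k , i+1+k≤0 , _) with () ← m+n≤o⇒n≤o i i+1+k≤0

proper-FinSub : ∀ {u v} → FinSub v (fin u) → v ≢ u → FinSub v (fin (dropLast u)) ⊎ FinSub v (fin (dropHead u))
proper-FinSub {u} (zero , k , k≤n , refl) v≢u with m≤n⇒m<n∨m≡n k≤n
... | inj₁ k<n  = inj₁ (FinSub-slice (fin u) {0} {i = 0} (suc[m]≤n⇒m≤pred[n] k<n))
... | inj₂ refl = ⊥-elim (v≢u (slice-full u))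
proper-FinSub {u} (suc i , k , i+k<n , refl) _ = inj₂ (FinSub-slice (fin u) {1} {i = i} (suc[m]≤n⇒m≤pred[n] i+k<n))

Shattered-dropLast : ∀ {u b B} → All (_< b) B → Shattered (fin u) (b ∷ B) → Shattered (fin (dropLast u)) B
Shattered-dropLast {u} {b} {B} B<b sh P with sh (update P b true)
... | _ , (i , k , i+k≤n , refl) , r = slice (fin u) i b , FinSub-slice (fin u) {0} i+b≤n-1 , realises
  where
  b<k : b < k
  b<k = proj₁ (∈n-slice⁻ (fin u) {i} {k} (Equivalence.from (r b (here refl)) (update-≡ P b true)))
  i+b≤n-1 : i + b ≤ pred (length u)
  i+b≤n-1 = suc[m]≤n⇒m≤pred[n] (<-≤-trans (+-monoʳ-< i b<k) i+k≤n)
  realises : Realises (slice (fin u) i b) P B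
  realises y y∈ = ⇔.trans (∈n-slice-shorten (fin u) (All.lookup B<b y∈) (<⇒≤ b<k))
    (subst (λ t → y ∈n slice (fin u) i k ⇔ t ≡ true) (update-≢ P true (>⇒≢ (All.lookup B<b y∈))) (r y (there y∈)))

length≤suc-length-filter< : ∀ {b B} → Unique B → All (_≤ b) B → length B ≤ suc (length (filter (_<? b) B))
length≤suc-length-filter< {b} {[]}    _          _            = z≤n
length≤suc-length-filter< {b} {x ∷ B} (x∉B ∷ uB) (x≤b ∷ B≤b) with x <? b
... | yes x<b = ≤-trans (s≤s (length≤suc-length-filter< uB B≤b))
                      (≤-reflexive (cong (suc ∘ length) (sym (filter-accept (_<? b) x<b))))
... | no  x≮b = s≤s (≤-reflexive (cong length (sym (trans (filter-reject (_<? b) x≮b) (filter-all (_<? b) B<b)))))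
  where
  B<b : All (_< b) B
  B<b = All.zipWith (λ (x≢y , y≤b) → ≤∧≢⇒< y≤b (λ y≡b → x≢y (trans (≤∧≮⇒≡ x≤b x≮b) (sym y≡b)))) (x∉B , B≤b)

max∈ : ∀ x xs → max x xs ∈ x ∷ xs
max∈ x xs with argmax-sel id x xs
... | inj₁ max≡x  = here max≡x
... | inj₂ max∈xs = there max∈xs

VCdim≥-dropLast : ∀ {u d} → VCdim≥ (fin u) (suc d) → VCdim≥ (fin (dropLast u)) d
VCdim≥-dropLast ([] , _ , () , _)
VCdim≥-dropLast {u} {d} (x ∷ B₀ , uB , |B|≡1+d , sh) = VCdim≥-antitone {fin (dropLast u)} d≤|B′|
  (B′ , Unique.filter⁺ (_<? b) uB , refl , Shattered-dropLast {u} (all-filter (_<? b) B) (ShatteredBy-⊆ b∷B′⊆B sh))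
  where
  B = x ∷ B₀
  b = max x B₀
  B′ = filter (_<? b) B
  d≤|B′| : d ≤ length B′
  d≤|B′| = s≤s⁻¹ (subst (_≤ suc (length B′)) |B|≡1+d (length≤suc-length-filter< uB (⊥≤max x B₀ ∷ xs≤max x B₀)))
  b∷B′⊆B : b ∷ B′ ⊆ B
  b∷B′⊆B (here refl) = max∈ x B₀
  b∷B′⊆B (there y∈)  = proj₁ (∈-filter⁻ (_<? b) y∈)

VCdim≥-nonempty : ∀ {u d} → VCdim≥ (fin u) (suc d) → 0 < length u
VCdim≥-nonempty ([] , _ , () , _)
VCdim≥-nonempty {u} (x ∷ _ , _ , _ , sh) = m<n⇒0<n (Shattered-<length {u} sh (here refl))

Minimal : ℕ → List Bool → Set
Minimal d u = ∀ v → FinSub v (fin u) → v ≢ u → ¬ VCdim≥ (fin v) d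

HasMinimal : ℕ → List Bool → Set
HasMinimal d u = ∃ λ v → FinSub v (fin u) × VCdim≥ (fin v) d × Minimal d v

HasMinimal-FinSub : ∀ {d t u} → FinSub t (fin u) → HasMinimal d t → HasMinimal d u
HasMinimal-FinSub {u = u} t⊑u (v , v⊑t , rest) = v , FinSub-trans (fin u) v⊑t t⊑u , rest

hasMinimal : ∀ d n u → length u ≤ n → VCdim≥ (fin u) d → HasMinimal d u
hasMinimal d n [] _ h = [] , FinSub-refl [] , h , λ v v⊑[] v≢[] → ⊥-elim (v≢[] (FinSub-[] v⊑[]))
hasMinimal d (suc n) (b ∷ u) |u|≤n h with VCdim≥? (dropLast (b ∷ u)) d | VCdim≥? (dropHead (b ∷ u)) d
... | yes hₗ | _      = HasMinimal-FinSub {t = dropLast (b ∷ u)} (dropLast-FinSub (b ∷ u))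
                          (hasMinimal d n (dropLast (b ∷ u)) (length-dropLast≤ {b ∷ u} |u|≤n) hₗ)
... | no _   | yes hₕ = HasMinimal-FinSub {t = dropHead (b ∷ u)} (dropHead-FinSub b u)
                          (hasMinimal d n (dropHead (b ∷ u)) (length-dropHead≤ {b ∷ u} |u|≤n) hₕ)
... | no ¬hₗ | no ¬hₕ = b ∷ u , FinSub-refl (b ∷ u) , h , λ v v⊑u v≢u → Sum.[
  (λ v⊑l → ¬hₗ ∘ VCdim≥-FinSub (fin (dropLast (b ∷ u))) v⊑l) ,
  (λ v⊑h → ¬hₕ ∘ VCdim≥-FinSub (fin (dropHead (b ∷ u))) v⊑h) ] (proper-FinSub v⊑u v≢u)

minimal⇒Prime : ∀ {d u} → VCdim≥ (fin u) d → Minimal d u → Prime d (fin u)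
minimal⇒Prime {d} {u} h minimal = (h , bounded) , proper
  where
  bounded : ∀ B → Unique B → Shattered (fin u) B → length B ≤ d
  bounded B uB sh with length B ≤? d
  ... | yes |B|≤d = |B|≤d
  ... | no  |B|≰d = ⊥-elim (minimal (dropLast u) (dropLast-FinSub u)
                             (dropLast-≢ {u} (VCdim≥-nonempty {u} big)) (VCdim≥-dropLast {u} big))
    where big = VCdim≥-antitone {fin u} (≰⇒> |B|≰d) (B , uB , refl , sh)
  proper : ∀ S′ → S′ ⊑ fin u → ¬ (S′ ≈S fin u) → ∀ d′ → HasVCdim S′ d′ → d′ < d
  proper (fin v) v⊑u v≢u d′ (h′ , _) with d′ <? d
  ... | yes d′<d = d′<d
  ... | no  d′≮d = ⊥-elim (minimal v v⊑u v≢u (VCdim≥-antitone {fin v} (≮⇒≥ d′≮d) h′))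

prime-substring : ∀ {S d} → VCdim≥ S d → ∃ λ S′ → S′ ⊑ S × Prime d S′
prime-substring {S} {d} h with VCdim≥-prefix h
... | T , T⊑S , hT with hasMinimal d (length T) T ≤-refl hT
...   | v , v⊑T , hv , minimal = fin v , FinSub-trans S v⊑T T⊑S , minimal⇒Prime hv minimal

proposition17 :
    ((S : BStr) (d : ℕ) → HasVCdim S (suc d) → ∃ λ S' → S' ⊑ S × Prime d S') ×
    ((S : BStr) (d : ℕ) → Prime (suc d) S → ∃ λ S' → S' ⊑ S × Prime d S')
proposition17 =
  (λ S d vc → prime-substring (VCdim≥-antitone (n≤1+n d) (proj₁ vc))) ,
  (λ S d prime → prime-substring (VCdim≥-antitone (n≤1+n d) (proj₁ (proj₁ prime))))
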